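{- Let $t$ be a $\lambda\mu$-term, $y$ a $\lambda$-variable, and $t'$ a term obtained from $t$ by reducing some $y$-redexes (i.e. $t$ reduces to $t'$ by a finite sequence of one-step reductions each of which contracts a $y$-redex). If $\Gamma,y:B\vdash t':A;\Delta$, then $\Gamma,y:B\vdash t:A;\Delta$.
   Context: $\lambda\mu$-terms over disjoint infinite sets of $\lambda$-variables and $\mu$-variables: $t ::= x \mid \lambda x.t \mid (t\,t) \mid \mu\alpha.t \mid (\alpha\,t)$. $u[\alpha:=^*v]$ replaces inductively each subterm $(\alpha\,w)$ of $u$ by $(\alpha\,(w\,v))$. One-step reduction is the compatible closure of $(\lambda x.u\;v)\triangleright u[x:=v]$ and $(\mu\alpha.u\;v)\triangleright\mu\alpha.u[\alpha:=^*v]$. For a $\lambda$-variable $y$, a $y$-redex is a redex whose argument is $y$: a term $(\lambda x.s\;y)$ or $(\mu\alpha.s\;y)$. Types: $A ::= X\mid\perp\mid A\to A$. Typing rules: (ax) $\Gamma\vdash x:A;\Delta$ if $x:A\in\Gamma$; ($\to_i$) from $\Gamma,x:A\vdash t:B;\Delta$ infer $\Gamma\vdash\lambda x.t:A\to B;\Delta$; ($\to_e$) from $\Gamma\vdash u:A\to B;\Delta$ and $\Gamma\vdash v:A;\Delta$ infer $\Gamma\vdash(u\,v):B;\Delta$; ($\mu$) from $\Gamma\vdash t:\perp;\Delta,\alpha:A$ infer $\Gamma\vdash\mu\alpha.t:A;\Delta$; ($\perp$) from $\Gamma\vdash t:A;\Delta,\alpha:A$ infer $\Gamma\vdash(\alpha\,t):\perp;\Delta,\alpha:A$.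 Here $\Gamma$ is a set of declarations $x:A$ (distinct $\lambda$-variables) and $\Delta$ a set of declarations $\alpha:B$ (distinct $\mu$-variables). -}

module Defs where

open import Data.Nat using (ℕ; zero; suc; _≟_; _<ᵇ_)
open import Data.Bool using (Bool; true; false; if_then_else_)
open import Data.List using (List; []; _∷_)
open import Relation.Nullary using (yes; no)
open import Relation.Binary.Construct.Closure.ReflexiveTransitive using (Star)

-- λμ-terms with de Bruijn indices; λ-variables and μ-variables live in
-- two separate index spaces (λ-binders bind λ-indices, μ-binders bind μ-indices).
data Term : Set where
  var   : ℕ → Term
  lam   : Term → Term
  app   : Term → Term → Term
  mu    : Term → Term
  named : ℕ → Term → Term

shiftλ : ℕ → Term → Term
shiftλ c (var x) = if x <ᵇ c then var x else var (suc x)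
shiftλ c (lam t) = lam (shiftλ (suc c) t)
shiftλ c (app t u) = app (shiftλ c t) (shiftλ c u)
shiftλ c (mu t) = mu (shiftλ c t)
shiftλ c (named α t) = named α (shiftλ c t)

shiftμ : ℕ → Term → Term
shiftμ c (var x) = var x
shiftμ c (lam t) = lam (shiftμ c t)
shiftμ c (app t u) = app (shiftμ c t) (shiftμ c u)
shiftμ c (mu t) = mu (shiftμ (suc c) t)
shiftμ c (named α t) = named (if α <ᵇ c then α else suc α) (shiftμ c t)

substλ : ℕ → Term → Term → Term
substλ j v (var x) with x <ᵇ j | x ≟ j
... | true  | _     = var x
... | false | yes _ = v
... | false | no _  = pred' x
  where
  pred' : ℕ → Term
  pred' zero = var zero
  pred' (suc n) = var n
substλ j v (lam t) = lam (substλ (suc j) (shiftλ 0 v) t)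
substλ j v (app t u) = app (substλ j v t) (substλ j v u)
substλ j v (mu t) = mu (substλ j (shiftμ 0 v) t)
substλ j v (named α t) = named α (substλ j v t)

-- t[k :=* v] : replace each subterm (k w) by (k (w v)), inductively
substμ : ℕ → Term → Term → Term
substμ k v (var x) = var x
substμ k v (lam t) = lam (substμ k (shiftλ 0 v) t)
substμ k v (app t u) = app (substμ k v t) (substμ k v u)
substμ k v (mu t) = mu (substμ (suc k) (shiftμ 0 v) t)
substμ k v (named α t) with α ≟ k
... | yes _ = named α (app (substμ k v t) v)
... | no _  = named α (substμ k v t)

data YStep : ℕ → Term → Term → Set where
  β-y   : ∀ {y u} → YStep y (app (lam u) (var y)) (substλ 0 (var y) u)
  μ-y   : ∀ {y u} → YStep y (app (mu u) (var y)) (mu (substμ 0 (shiftμ 0 (var y)) u))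
  ξ-lam : ∀ {y t t'} → YStep (suc y) t t' → YStep y (lam t) (lam t')
  ξ-appˡ : ∀ {y t t' u} → YStep y t t' → YStep y (app t u) (app t' u)
  ξ-appʳ : ∀ {y t u u'} → YStep y u u' → YStep y (app t u) (app t u')
  ξ-mu  : ∀ {y t t'} → YStep y t t' → YStep y (mu t) (mu t')
  ξ-named : ∀ {y α t t'} → YStep y t t' → YStep y (named α t) (named α t')

YSteps : ℕ → Term → Term → Set
YSteps y = Star (YStep y)

data Type : Set where
  tvar : ℕ → Type
  ⊥'   : Type
  _⇒_  : Type → Type → Type

infixr 7 _⇒_

data _∋_∶_ : List Type → ℕ → Type → Set where
  here  : ∀ {Γ A} → (A ∷ Γ) ∋ zero ∶ A
  there : ∀ {Γ A B n} → Γ ∋ n ∶ A → (B ∷ Γ) ∋ suc n ∶ A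

data _⊢_∶_∣_ : List Type → Term → Type → List Type → Set where
  ax    : ∀ {Γ Δ x A} → Γ ∋ x ∶ A → Γ ⊢ var x ∶ A ∣ Δ
  →i    : ∀ {Γ Δ t A B} → (A ∷ Γ) ⊢ t ∶ B ∣ Δ → Γ ⊢ lam t ∶ A ⇒ B ∣ Δ
  →e    : ∀ {Γ Δ u v A B} → Γ ⊢ u ∶ A ⇒ B ∣ Δ → Γ ⊢ v ∶ A ∣ Δ → Γ ⊢ app u v ∶ B ∣ Δ
  μi    : ∀ {Γ Δ t A} → Γ ⊢ t ∶ ⊥' ∣ (A ∷ Δ) → Γ ⊢ mu t ∶ A ∣ Δ
  ⊥i    : ∀ {Γ Δ α t A} → Δ ∋ α ∶ A → Γ ⊢ t ∶ A ∣ Δ → Γ ⊢ named α t ∶ ⊥' ∣ Δ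

module Submission where

-- It suffices to treat one step; the
-- theorem then follows by induction on the reduction sequence. Reducing a
-- congruence step is immediate by induction on the step, so the content lies
-- in the two root redexes (λx.u y) and (μα.u y), where y : B. Each is handled
-- by a "reflection" lemma reading a typing of the contractum back into a
-- typing of the body:
--   * u[x:=y] : A in Γ  gives  u : A in Γ, x:B   (substituting a variable
--     of type B reflects typings; proved for insertion at any depth j);
--   * u[α:=*y] : T with α:A  gives  u : T with α:B→A   (every (α w) in the
--     contractum has become (α (w y)), whose typing forces w : B→A).
-- Both are proved by induction on the term, using that variable lookup in a
-- context is functional.

open import Defs
open import Data.Nat using (ℕ; zero; suc; _<_; _≤_; _≟_; _<ᵇ_; s≤s; s<s)
open import Data.Nat.Properties using (<ᵇ⇒<; <⇒<ᵇ; ≮⇒≥; ≤∧≢⇒<)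
open import Data.Bool using (true; false; T)
open import Data.Unit using (tt)
open import Data.List using (List; _∷_)
open import Function using (_∘_)
open import Relation.Nullary using (yes; no; ¬_)
open import Relation.Binary.PropositionalEquality using (_≡_; refl; sym; cong; subst)
open import Relation.Binary.Construct.Closure.ReflexiveTransitive using (ε; _◅_)
open import Data.Empty using (⊥-elim)

lookup-unique : ∀ {Γ n A A'} → Γ ∋ n ∶ A → Γ ∋ n ∶ A' → A ≡ A'
lookup-unique here      here      = refl
lookup-unique (there p) (there q) = lookup-unique p q

<ᵇ-true⇒< : ∀ {m n} → (m <ᵇ n) ≡ true → m < n
<ᵇ-true⇒< {m} {n} m<ᵇn = <ᵇ⇒< m n (subst T (sym m<ᵇn) tt)

<ᵇ-false⇒≥ : ∀ {m n} → (m <ᵇ n) ≡ false → n ≤ m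
<ᵇ-false⇒≥ m≮ᵇn = ≮⇒≥ (λ m<n → subst T m≮ᵇn (<⇒<ᵇ m<n))

-- Insert j C Γ Γ' : Γ' is Γ with the declaration C inserted at position j.
-- This is the context of the body of a λ-abstraction seen j binders deep.
data Insert : ℕ → Type → List Type → List Type → Set where
  insert-here  : ∀ {C Γ} → Insert zero C Γ (C ∷ Γ)
  insert-there : ∀ {j C Γ Γ' X} → Insert j C Γ Γ' → Insert (suc j) C (X ∷ Γ) (X ∷ Γ')

insert-below : ∀ {j C Γ Γ' x A} → Insert j C Γ Γ' → x < j → Γ ∋ x ∶ A → Γ' ∋ x ∶ A
insert-below (insert-there i) _         here      = here
insert-below (insert-there i) (s<s x<j) (there p) = there (insert-below i x<j p)

insert-at : ∀ {j C Γ Γ'} → Insert j C Γ Γ' → Γ' ∋ j ∶ C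
insert-at insert-here      = here
insert-at (insert-there i) = there (insert-at i)

insert-above : ∀ {j C Γ Γ' x A} → Insert j C Γ Γ' → j ≤ x → Γ ∋ x ∶ A → Γ' ∋ suc x ∶ A
insert-above insert-here      _         p         = there p
insert-above (insert-there i) (s≤s j≤x) (there p) = there (insert-above i j≤x p)

substλ-var-reflect : ∀ {j C Γ Γ' z x A Δ} → Insert j C Γ Γ' → Γ ∋ z ∶ C →
  Γ ⊢ substλ j (var z) (var x) ∶ A ∣ Δ → Γ' ∋ x ∶ A
substλ-var-reflect {j} {x = x} i zC d with x <ᵇ j in x<ᵇj | x ≟ j | d
... | true  | _        | ax p = insert-below i (<ᵇ-true⇒< x<ᵇj) p
... | false | yes refl | ax p rewrite lookup-unique p zC = insert-at i
... | false | no x≢j   | d′ with ≤∧≢⇒< (<ᵇ-false⇒≥ x<ᵇj) (x≢j ∘ sym) | d′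
...   | s≤s j≤n | ax p = insert-above i j≤n p

substλ-reflect : ∀ {j C Γ Γ' z u A Δ} → Insert j C Γ Γ' → Γ ∋ z ∶ C →
  Γ ⊢ substλ j (var z) u ∶ A ∣ Δ → Γ' ⊢ u ∶ A ∣ Δ
substλ-reflect {u = var x}     i zC d         = ax (substλ-var-reflect i zC d)
substλ-reflect {u = lam u}     i zC (→i d)    = →i (substλ-reflect (insert-there i) (there zC) d)
substλ-reflect {u = app u v}   i zC (→e d e)  = →e (substλ-reflect i zC d) (substλ-reflect i zC e)
substλ-reflect {u = mu u}      i zC (μi d)    = μi (substλ-reflect i zC d)
substλ-reflect {u = named α u} i zC (⊥i p d)  = ⊥i p (substλ-reflect i zC d)

-- Retype k A A' Δ Δ' : Δ' is Δ with the declaration A at position k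
-- replaced by A'. This relates the μ-contexts before and after a μ-redex.
data Retype : ℕ → Type → Type → List Type → List Type → Set where
  retype-here  : ∀ {A A' Δ} → Retype zero A A' (A ∷ Δ) (A' ∷ Δ)
  retype-there : ∀ {k A A' Δ Δ' X} → Retype k A A' Δ Δ' → Retype (suc k) A A' (X ∷ Δ) (X ∷ Δ')

retype-old : ∀ {k A A' Δ Δ'} → Retype k A A' Δ Δ' → Δ ∋ k ∶ A
retype-old retype-here      = here
retype-old (retype-there r) = there (retype-old r)

retype-new : ∀ {k A A' Δ Δ'} → Retype k A A' Δ Δ' → Δ' ∋ k ∶ A'
retype-new retype-here      = here
retype-new (retype-there r) = there (retype-new r)

retype-other : ∀ {k A A' Δ Δ' α X} → Retype k A A' Δ Δ' → ¬ (α ≡ k) → Δ ∋ α ∶ X → Δ' ∋ α ∶ X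
retype-other retype-here      α≢k here      = ⊥-elim (α≢k refl)
retype-other retype-here      α≢k (there p) = there p
retype-other (retype-there r) α≢k here      = here
retype-other (retype-there r) α≢k (there p) = there (retype-other r (α≢k ∘ cong suc) p)

-- Structural substitution of a variable z of type B at the μ-index k of
-- type A reflects typings, with k retyped to B ⇒ A: each (k (w z)) in the
-- contractum is typed with w : B ⇒ A, since z can only have type B.
substμ-reflect : ∀ {k A B Δ Δ' Γ z u T} → Retype k A (B ⇒ A) Δ Δ' → Γ ∋ z ∶ B →
  Γ ⊢ substμ k (var z) u ∶ T ∣ Δ → Γ ⊢ u ∶ T ∣ Δ'
substμ-reflect {u = var x}   r zB (ax p)   = ax p
substμ-reflect {u = lam u}   r zB (→i d)   = →i (substμ-reflect r (there zB) d)
substμ-reflect {u = app u v} r zB (→e d e) = →e (substμ-reflect r zB d) (substμ-reflect r zB e)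
substμ-reflect {u = mu u}    r zB (μi d)   = μi (substμ-reflect (retype-there r) zB d)
substμ-reflect {k} {u = named α u} r zB d with α ≟ k
substμ-reflect {k} {u = named α u} r zB (⊥i p (→e d (ax q))) | yes refl
  with lookup-unique q zB | lookup-unique p (retype-old r)
... | refl | refl = ⊥i (retype-new r) (substμ-reflect r zB d)
substμ-reflect {k} {u = named α u} r zB (⊥i p d) | no α≢k =
  ⊥i (retype-other r α≢k p) (substμ-reflect r zB d)

ystep-expand : ∀ {Γ Δ y B A t t'} → Γ ∋ y ∶ B → YStep y t t' → Γ ⊢ t' ∶ A ∣ Δ → Γ ⊢ t ∶ A ∣ Δ
ystep-expand yB β-y         d        = →e (→i (substλ-reflect insert-here yB d)) (ax yB)
ystep-expand yB μ-y         (μi d)   = →e (μi (substμ-reflect retype-here yB d)) (ax yB)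
ystep-expand yB (ξ-lam s)   (→i d)   = →i (ystep-expand (there yB) s d)
ystep-expand yB (ξ-appˡ s)  (→e d e) = →e (ystep-expand yB s d) e
ystep-expand yB (ξ-appʳ s)  (→e d e) = →e d (ystep-expand yB s e)
ystep-expand yB (ξ-mu s)    (μi d)   = μi (ystep-expand yB s d)
ystep-expand yB (ξ-named s) (⊥i p d) = ⊥i p (ystep-expand yB s d)

lemma3p5 : ∀ {Γ Δ : List Type} {y : ℕ} {B A : Type} {t t' : Term} →
    Γ ∋ y ∶ B → YSteps y t t' → Γ ⊢ t' ∶ A ∣ Δ → Γ ⊢ t ∶ A ∣ Δ
lemma3p5 yB ε        d = d
lemma3p5 yB (s ◅ ss) d = ystep-expand yB s (lemma3p5 yB ss d)
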